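{- Let $s,t,a,b$ be integers with $2\le a\le s$, $2\le b\le t$ and $ab\ge s+t$. Then $$r\!\left(K_{n,n},K_{s,t},st-ab+2\right)=\Omega\!\left(n^{1/\min\{a,b\}}\right).$$
   Context: For graphs $G,H$ and an integer $q$ with $2\le q\le |E(H)|$, an $(H,q)$-coloring of $G$ is an edge-coloring of $G$ in which every subgraph of $G$ isomorphic to $H$ receives at least $q$ distinct colors; $r(G,H,q)$ is the minimum number of colors needed for $G$ to have an $(H,q)$-coloring. $K_{n,n}$, $K_{s,t}$ denote complete bipartite graphs. Asymptotic notation refers to $n\to\infty$ with $s,t,a,b$ fixed. -}

module Defs where

open import Data.Nat using (ℕ; _≤_)
open import Data.Fin using (Fin)
open import Data.Sum using (_⊎_; inj₁; inj₂)
open import Data.Product using (_×_; _,_; Σ)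
open import Function.Definitions using (Injective)
open import Relation.Binary.PropositionalEquality using (_≡_)

-- Vertex set of the complete bipartite graph K_{m,p}:
-- left part Fin m (inj₁), right part Fin p (inj₂).
KV : ℕ → ℕ → Set
KV m p = Fin m ⊎ Fin p

data Adj {n : ℕ} : KV n n → KV n n → Set where
  lr : (x y : Fin n) → Adj (inj₁ x) (inj₂ y)
  rl : (x y : Fin n) → Adj (inj₂ y) (inj₁ x)

-- An edge-coloring of K_{n,n} with k colors: the edge {x,y}
-- (x in the left part, y in the right part) gets colour c x y.
EdgeColoring : ℕ → ℕ → Set
EdgeColoring n k = Fin n → Fin n → Fin k

colourOf : {n k : ℕ} → EdgeColoring n k → {u v : KV n n} → Adj u v → Fin k
colourOf c (lr x y) = c x y
colourOf c (rl x y) = c x y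

-- A subgraph of K_{n,n} isomorphic to K_{s,t}, given as an embedding:
-- an injective vertex map sending every edge of K_{s,t} to an edge of K_{n,n}
-- (the copy is the image of the embedding).
record Copy (n s t : ℕ) : Set where
  field
    φ     : KV s t → KV n n
    φ-inj : Injective _≡_ _≡_ φ
    edge  : (i : Fin s) (j : Fin t) → Adj (φ (inj₁ i)) (φ (inj₂ j))

copyColour : {n k s t : ℕ} → EdgeColoring n k → Copy n s t → Fin s × Fin t → Fin k
copyColour c K (i , j) = colourOf c (Copy.edge K i j)

AtLeastColours : {n k s t : ℕ} → ℕ → EdgeColoring n k → Copy n s t → Set
AtLeastColours q c K =
  Σ (Fin q → _) λ g → Injective _≡_ _≡_ (λ e → copyColour c K (g e))

IsHqColoring : (n k s t q : ℕ) → EdgeColoring n k → Set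
IsHqColoring n k s t q c = (K : Copy n s t) → AtLeastColours q c K

module Submission where

-- A coloring in which every copy of K_{s,t} shows st − ab + 2 colours has no monochromatic K_{a,b}:
-- a copy of K_{s,t} containing one shows at most st − ab + 1 colours, and a K_{a,b} among the first
-- n − (s + t) vertices of each side extends to such a copy through the remaining s + t vertices.
-- So every colour class is K_{a,b}-free, and the Kővári–Sós–Turán double count applies to it: with
-- P = min(a,b), counting vertices y together with P-sequences of distinct neighbours of y gives
-- ∑_y (d(y) − P)^P ≤ (max(a,b) − 1) n^P.  As the k colour classes share all n² edges, the power-mean
-- inequality turns this into n ≤ C k^P.

open import Defs
open import Data.Bool.Base using (true; false; if_then_else_)
open import Data.Empty using (⊥-elim)
open import Data.Fin using (Fin; toℕ; fromℕ<)
open import Data.Fin.Properties using (toℕ-injective; toℕ-fromℕ<; toℕ<n; pigeonhole)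
open import Data.List using (List; []; _∷_; length; filter; downFrom)
open import Data.List.Relation.Unary.All using (All; []; _∷_; all?)
open import Data.List.Relation.Unary.All.Properties using (¬Any⇒All¬; All-swap; applyDownFrom⁺₁; all-filter)
import Data.List.Relation.Unary.All.Properties as All
import Data.List.Relation.Unary.AllPairs as AllPairs
open import Data.List.Relation.Unary.Unique.Propositional using (Unique)
import Data.List.Relation.Unary.Unique.Propositional.Properties as Unique
open import Data.Nat
open import Data.Nat.DivMod using (_mod_; m<n⇒m%n≡m)
open import Data.Nat.Properties
open import Data.Nat.Tactic.RingSolver using (solve-∀)
open import Data.Product using (_×_; _,_; proj₁; proj₂; ∃-syntax)
open import Data.Sum using (_⊎_; inj₁; inj₂)
open import Data.Sum.Properties using (inj₁-injective; inj₂-injective)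
open import Function using (_∘_; id; flip)
open import Function.Definitions using (Injective)
open import Relation.Binary.Definitions using (tri<; tri≈; tri>)
open import Relation.Binary.PropositionalEquality
open import Relation.Nullary using (Dec; yes; no; ¬_; does; ¬?; _×-dec_; _⊎-dec_)
open import Relation.Nullary.Decidable using (dec-true; dec-false)
open import Relation.Unary using (Decidable)

open import Data.List.Membership.DecPropositional _≟_ using (_∈?_)

-- Finite sums

∑< : ℕ → (ℕ → ℕ) → ℕ
∑< zero    f = 0
∑< (suc n) f = ∑< n f + f n

infix 5 ∑<
syntax ∑< n (λ i → e) = ∑[ i < n ] e

module _ {f g : ℕ → ℕ} where

  ∑-cong : ∀ n → (∀ i → i < n → f i ≡ g i) → ∑< n f ≡ ∑< n g
  ∑-cong zero    _  = refl
  ∑-cong (suc n) eq = cong₂ _+_ (∑-cong n (λ i i<n → eq i (m<n⇒m<1+n i<n))) (eq n ≤-refl)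

  ∑-mono-≤ : ∀ n → (∀ i → i < n → f i ≤ g i) → ∑< n f ≤ ∑< n g
  ∑-mono-≤ zero    _  = z≤n
  ∑-mono-≤ (suc n) le = +-mono-≤ (∑-mono-≤ n (λ i i<n → le i (m<n⇒m<1+n i<n))) (le n ≤-refl)

  ∑-distrib-+ : ∀ n → ∑[ i < n ] (f i + g i) ≡ ∑< n f + ∑< n g
  ∑-distrib-+ zero    = refl
  ∑-distrib-+ (suc n) rewrite ∑-distrib-+ n = interchange (∑< n f) (∑< n g) (f n) (g n)
    where
    interchange : ∀ a b c d → (a + b) + (c + d) ≡ (a + c) + (b + d)
    interchange = solve-∀

∑-const : ∀ n c → ∑< n (λ _ → c) ≡ n * c
∑-const zero    c = refl
∑-const (suc n) c rewrite ∑-const n c = +-comm (n * c) c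

∑-bounded : ∀ n c {f : ℕ → ℕ} → (∀ i → i < n → f i ≤ c) → ∑< n f ≤ n * c
∑-bounded n c {f} le = subst (∑< n f ≤_) (∑-const n c) (∑-mono-≤ n le)

*-distribˡ-∑ : ∀ n c (f : ℕ → ℕ) → c * ∑< n f ≡ ∑[ i < n ] c * f i
*-distribˡ-∑ zero    c f = *-zeroʳ c
*-distribˡ-∑ (suc n) c f rewrite sym (*-distribˡ-∑ n c f) = *-distribˡ-+ c (∑< n f) (f n)

*-distribʳ-∑ : ∀ n c (f : ℕ → ℕ) → ∑< n f * c ≡ ∑[ i < n ] f i * c
*-distribʳ-∑ zero    c f = refl
*-distribʳ-∑ (suc n) c f rewrite sym (*-distribʳ-∑ n c f) = *-distribʳ-+ c (∑< n f) (f n)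

term≤∑ : ∀ n {f : ℕ → ℕ} {i} → i < n → f i ≤ ∑< n f
term≤∑ (suc n) {f} {i} i<1+n with m<1+n⇒m<n∨m≡n i<1+n
... | inj₁ i<n  = ≤-trans (term≤∑ n i<n) (m≤m+n (∑< n f) (f n))
... | inj₂ refl = m≤n+m (f i) (∑< n f)

∑-comm : ∀ m n (f : ℕ → ℕ → ℕ) → ∑[ i < m ] ∑[ j < n ] f i j ≡ ∑[ j < n ] ∑[ i < m ] f i j
∑-comm zero    n f = sym (trans (∑-const n 0) (*-zeroʳ n))
∑-comm (suc m) n f rewrite ∑-comm m n f = sym (∑-distrib-+ n)

∑∑-distrib-+ : ∀ m n (f g : ℕ → ℕ → ℕ) →
  ∑[ i < m ] ∑[ j < n ] (f i j + g i j) ≡ (∑[ i < m ] ∑[ j < n ] f i j) + (∑[ i < m ] ∑[ j < n ] g i j)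
∑∑-distrib-+ m n f g = trans (∑-cong m (λ i _ → ∑-distrib-+ n)) (∑-distrib-+ m)

∑-product : ∀ m n (f g : ℕ → ℕ) → ∑[ i < m ] ∑[ j < n ] f i * g j ≡ ∑< m f * ∑< n g
∑-product m n f g = begin
  ∑[ i < m ] ∑[ j < n ] f i * g j ≡⟨ ∑-cong m (λ i _ → *-distribˡ-∑ n (f i) g) ⟨
  ∑[ i < m ] f i * ∑< n g        ≡⟨ *-distribʳ-∑ m (∑< n g) f ⟨
  ∑< m f * ∑< n g               ∎
  where open ≡-Reasoning

-- Indicators of decidable propositions

𝟙 : ∀ {p} {P : Set p} → Dec P → ℕ
𝟙 d = if does d then 1 else 0

module _ {p} {P : Set p} where

  𝟙≤1 : (d : Dec P) → 𝟙 d ≤ 1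
  𝟙≤1 (yes _) = ≤-refl
  𝟙≤1 (no _)  = z≤n

  𝟙-true : (d : Dec P) → P → 𝟙 d ≡ 1
  𝟙-true d x rewrite dec-true d x = refl

  𝟙-false : (d : Dec P) → ¬ P → 𝟙 d ≡ 0
  𝟙-false d ¬x rewrite dec-false d ¬x = refl

  𝟙-¬ : (d : Dec P) → 𝟙 (¬? d) + 𝟙 d ≡ 1
  𝟙-¬ (yes _) = refl
  𝟙-¬ (no _)  = refl

module _ {p q} {P : Set p} {Q : Set q} where

  𝟙-× : (d : Dec P) (e : Dec Q) → 𝟙 (d ×-dec e) ≡ 𝟙 d * 𝟙 e
  𝟙-× (yes _) e = sym (+-identityʳ (𝟙 e))
  𝟙-× (no _)  e = refl

  𝟙-⊎ : (d : Dec P) (e : Dec Q) → 𝟙 (d ⊎-dec e) ≤ 𝟙 d + 𝟙 e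
  𝟙-⊎ (yes _) e = s≤s z≤n
  𝟙-⊎ (no _)  e = ≤-refl

module _ {p} {P : ℕ → Set p} (P? : Decidable P) where

  ∑-𝟙-none : ∀ n → (∀ i → i < n → ¬ P i) → ∑[ i < n ] 𝟙 (P? i) ≡ 0
  ∑-𝟙-none zero    _    = refl
  ∑-𝟙-none (suc n) none
    rewrite ∑-𝟙-none n (λ i i<n → none i (m<n⇒m<1+n i<n)) | 𝟙-false (P? n) (none n ≤-refl) = refl

  ∑-𝟙-≤1 : ∀ n → (∀ {i j} → P i → P j → i ≡ j) → ∑[ i < n ] 𝟙 (P? i) ≤ 1
  ∑-𝟙-≤1 zero    _      = z≤n
  ∑-𝟙-≤1 (suc n) unique with P? n
  ... | yes Pn rewrite ∑-𝟙-none n (λ i i<n Pi → <-irrefl (unique Pi Pn) i<n) = ≤-refl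
  ... | no  _  rewrite +-identityʳ (∑[ i < n ] 𝟙 (P? i)) = ∑-𝟙-≤1 n unique

  ∑-𝟙-≡1 : ∀ n {v} → v < n → P v → (∀ {i j} → P i → P j → i ≡ j) → ∑[ i < n ] 𝟙 (P? i) ≡ 1
  ∑-𝟙-≡1 n {v} v<n Pv unique =
    ≤-antisym (∑-𝟙-≤1 n unique) (subst (_≤ ∑[ i < n ] 𝟙 (P? i)) (𝟙-true (P? v) Pv) (term≤∑ n v<n))

  length-filter-downFrom : ∀ n → length (filter P? (downFrom n)) ≡ ∑[ i < n ] 𝟙 (P? i)
  length-filter-downFrom zero = refl
  length-filter-downFrom (suc n) with does (P? n)
  ... | true  = trans (cong suc (length-filter-downFrom n)) (+-comm 1 _)
  ... | false = trans (length-filter-downFrom n) (sym (+-identityʳ _))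

-- Chebyshev and power-mean inequalities

-- Writing y = x + d and v = u + e, the right side exceeds the left by d * e.
rearrangement : ∀ x y u v → x ≤ y → u ≤ v → x * v + y * u ≤ x * u + y * v
rearrangement x y u v x≤y u≤v =
  subst₂ (λ v y → x * v + y * u ≤ x * u + y * v) (m+[n∸m]≡n u≤v) (m+[n∸m]≡n x≤y)
    (subst (x * (u + (v ∸ u)) + (x + (y ∸ x)) * u ≤_) (sym (expand x (y ∸ x) u (v ∸ u))) (m≤m+n _ _))
  where
  expand : ∀ x d u e → x * u + (x + d) * (u + e) ≡ (x * (u + e) + (x + d) * u) + d * e
  expand = solve-∀

rearrangement-similar : ∀ x y u v → (x ≤ y → u ≤ v) → (y ≤ x → v ≤ u) → x * v + y * u ≤ x * u + y * v
rearrangement-similar x y u v xy⇒uv yx⇒vu with ≤-total x y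
... | inj₁ x≤y = rearrangement x y u v x≤y (xy⇒uv x≤y)
... | inj₂ y≤x = subst₂ _≤_ (+-comm (y * u) (x * v)) (+-comm (y * v) (x * u))
                   (rearrangement y x v u y≤x (yx⇒vu y≤x))

chebyshev : ∀ N (h g : ℕ → ℕ) → (∀ i j → h i ≤ h j → g i ≤ g j) →
  ∑< N h * ∑< N g ≤ N * (∑[ i < N ] h i * g i)
chebyshev N h g similar = *-cancelˡ-≤ 2 (begin
  2 * (H * G)                                    ≡⟨ mixed ⟨
  ∑[ i < N ] ∑[ j < N ] (h i * g j + h j * g i)  ≤⟨ ∑-mono-≤ N (λ i _ → ∑-mono-≤ N (λ j _ →
                                                      rearrangement-similar (h i) (h j) (g i) (g j) (similar i j) (similar j i))) ⟩
  ∑[ i < N ] ∑[ j < N ] (h i * g i + h j * g j)  ≡⟨ diagonal ⟩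
  2 * (N * S)                                    ∎)
  where
  open ≤-Reasoning
  H G S : ℕ
  H = ∑< N h
  G = ∑< N g
  S = ∑[ i < N ] h i * g i
  mixed : ∑[ i < N ] ∑[ j < N ] (h i * g j + h j * g i) ≡ 2 * (H * G)
  mixed = begin-equality
    ∑[ i < N ] ∑[ j < N ] (h i * g j + h j * g i)
      ≡⟨ ∑∑-distrib-+ N N (λ i j → h i * g j) (λ i j → h j * g i) ⟩
    (∑[ i < N ] ∑[ j < N ] h i * g j) + (∑[ i < N ] ∑[ j < N ] h j * g i)
      ≡⟨ cong ((∑[ i < N ] ∑[ j < N ] h i * g j) +_) (∑-comm N N (λ i j → h j * g i)) ⟩
    (∑[ i < N ] ∑[ j < N ] h i * g j) + (∑[ j < N ] ∑[ i < N ] h j * g i)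
      ≡⟨ cong₂ _+_ (∑-product N N h g) (∑-product N N h g) ⟩
    H * G + H * G
      ≡⟨ cong (H * G +_) (+-identityʳ (H * G)) ⟨
    2 * (H * G) ∎
  diagonal : ∑[ i < N ] ∑[ j < N ] (h i * g i + h j * g j) ≡ 2 * (N * S)
  diagonal = begin-equality
    ∑[ i < N ] ∑[ j < N ] (h i * g i + h j * g j)
      ≡⟨ ∑∑-distrib-+ N N (λ i j → h i * g i) (λ i j → h j * g j) ⟩
    (∑[ i < N ] ∑[ j < N ] h i * g i) + (∑[ i < N ] S)
      ≡⟨ cong₂ _+_ (∑-cong N (λ i _ → ∑-const N (h i * g i))) (∑-const N S) ⟩
    (∑[ i < N ] N * (h i * g i)) + N * S
      ≡⟨ cong (_+ N * S) (*-distribˡ-∑ N N (λ i → h i * g i)) ⟨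
    N * S + N * S
      ≡⟨ cong (N * S +_) (+-identityʳ (N * S)) ⟨
    2 * (N * S) ∎

^-distribʳ-* : ∀ m n p → (m * n) ^ p ≡ m ^ p * n ^ p
^-distribʳ-* m n zero    = refl
^-distribʳ-* m n (suc p) rewrite ^-distribʳ-* m n p = [m*n]*[o*p]≡[m*o]*[n*p] m n (m ^ p) (n ^ p)

power-mean : ∀ N p (h : ℕ → ℕ) → ∑< N h ^ suc p ≤ N ^ p * (∑[ i < N ] h i ^ suc p)
power-mean N zero h = begin
  ∑< N h * 1                   ≡⟨ *-identityʳ _ ⟩
  ∑< N h                       ≡⟨ ∑-cong N (λ i _ → *-identityʳ (h i)) ⟨
  ∑[ i < N ] h i ^ 1           ≡⟨ +-identityʳ _ ⟨
  1 * (∑[ i < N ] h i ^ 1)     ∎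
  where open ≤-Reasoning
power-mean N (suc p) h = begin
  H * H ^ suc p                                 ≤⟨ *-monoʳ-≤ H (power-mean N p h) ⟩
  H * (N ^ p * (∑[ i < N ] h i ^ suc p))        ≡⟨ x*[y*z]≡y*[x*z] H (N ^ p) _ ⟩
  N ^ p * (H * (∑[ i < N ] h i ^ suc p))        ≤⟨ *-monoʳ-≤ (N ^ p)
                                                     (chebyshev N h (λ i → h i ^ suc p) (λ i j → ^-monoˡ-≤ (suc p))) ⟩
  N ^ p * (N * (∑[ i < N ] h i * h i ^ suc p))  ≡⟨ *-assoc (N ^ p) N _ ⟨
  N ^ p * N * (∑[ i < N ] h i * h i ^ suc p)    ≡⟨ cong (_* (∑[ i < N ] h i * h i ^ suc p)) (*-comm (N ^ p) N) ⟩
  N * N ^ p * (∑[ i < N ] h i * h i ^ suc p)    ∎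
  where
  open ≤-Reasoning
  H : ℕ
  H = ∑< N h
  x*[y*z]≡y*[x*z] : ∀ x y z → x * (y * z) ≡ y * (x * z)
  x*[y*z]≡y*[x*z] = solve-∀

-- Kővári–Sós–Turán double counting

∑-∈≤length : ∀ n xs → ∑[ x < n ] 𝟙 (x ∈? xs) ≤ length xs
∑-∈≤length n []       = ≤-reflexive (trans (∑-const n 0) (*-zeroʳ n))
∑-∈≤length n (z ∷ zs) = begin
  ∑[ x < n ] 𝟙 (x ∈? z ∷ zs)                          ≤⟨ ∑-mono-≤ n (λ x _ → 𝟙-⊎ (x ≟ z) (x ∈? zs)) ⟩
  ∑[ x < n ] (𝟙 (x ≟ z) + 𝟙 (x ∈? zs))                ≡⟨ ∑-distrib-+ n ⟩
  (∑[ x < n ] 𝟙 (x ≟ z)) + (∑[ x < n ] 𝟙 (x ∈? zs))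
    ≤⟨ +-mono-≤ (∑-𝟙-≤1 (_≟ z) n (λ p q → trans p (sym q))) (∑-∈≤length n zs) ⟩
  suc (length zs)                                      ∎
  where open ≤-Reasoning

module BipartiteGraph {ℓ} {E : ℕ → ℕ → Set ℓ} (E? : ∀ x y → Dec (E x y)) (n : ℕ) where

  deg : ℕ → ℕ
  deg y = ∑[ x < n ] 𝟙 (E? x y)

  fresh : ℕ → List ℕ → ℕ
  fresh x xs = 𝟙 (¬? (x ∈? xs))

  extensions : ℕ → List ℕ → ℕ → ℕ
  extensions zero    xs y = 1
  extensions (suc p) xs y = ∑[ x < n ] fresh x xs * 𝟙 (E? x y) * extensions p (x ∷ xs) y

  adjacentToAll : List ℕ → ℕ → ℕ
  adjacentToAll xs y = 𝟙 (all? (λ x → E? x y) xs)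

  codegree : List ℕ → ℕ
  codegree xs = ∑[ y < n ] adjacentToAll xs y

  deg≤fresh-neighbours+length : ∀ xs y → deg y ≤ (∑[ x < n ] fresh x xs * 𝟙 (E? x y)) + length xs
  deg≤fresh-neighbours+length xs y = begin
    ∑[ x < n ] 𝟙 (E? x y)                                      ≤⟨ ∑-mono-≤ n (λ x _ → split x) ⟩
    ∑[ x < n ] (fresh x xs * 𝟙 (E? x y) + 𝟙 (x ∈? xs))         ≡⟨ ∑-distrib-+ n ⟩
    (∑[ x < n ] fresh x xs * 𝟙 (E? x y)) + (∑[ x < n ] 𝟙 (x ∈? xs)) ≤⟨ +-monoʳ-≤ _ (∑-∈≤length n xs) ⟩
    (∑[ x < n ] fresh x xs * 𝟙 (E? x y)) + length xs           ∎
    where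
    open ≤-Reasoning
    split : ∀ x → 𝟙 (E? x y) ≤ fresh x xs * 𝟙 (E? x y) + 𝟙 (x ∈? xs)
    split x = begin
      𝟙 (E? x y)                                        ≡⟨ *-identityˡ _ ⟨
      1 * 𝟙 (E? x y)                                    ≡⟨ cong (_* 𝟙 (E? x y)) (𝟙-¬ (x ∈? xs)) ⟨
      (fresh x xs + 𝟙 (x ∈? xs)) * 𝟙 (E? x y)           ≡⟨ *-distribʳ-+ (𝟙 (E? x y)) (fresh x xs) (𝟙 (x ∈? xs)) ⟩
      fresh x xs * 𝟙 (E? x y) + 𝟙 (x ∈? xs) * 𝟙 (E? x y)
        ≤⟨ +-monoʳ-≤ (fresh x xs * 𝟙 (E? x y)) (*-monoʳ-≤ (𝟙 (x ∈? xs)) (𝟙≤1 (E? x y))) ⟩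
      fresh x xs * 𝟙 (E? x y) + 𝟙 (x ∈? xs) * 1         ≡⟨ cong (fresh x xs * 𝟙 (E? x y) +_) (*-identityʳ _) ⟩
      fresh x xs * 𝟙 (E? x y) + 𝟙 (x ∈? xs)             ∎

  [deg∸p]^p≤extensions : ∀ p xs y → (deg y ∸ (length xs + p)) ^ p ≤ extensions p xs y
  [deg∸p]^p≤extensions zero    xs y = ≤-refl
  [deg∸p]^p≤extensions (suc p) xs y = begin
    D * D ^ p                                                      ≤⟨ *-monoˡ-≤ (D ^ p) D≤fresh ⟩
    (∑[ x < n ] fresh x xs * 𝟙 (E? x y)) * D ^ p                   ≡⟨ *-distribʳ-∑ n (D ^ p) _ ⟩
    ∑[ x < n ] fresh x xs * 𝟙 (E? x y) * D ^ p                     ≤⟨ ∑-mono-≤ n (λ x _ → *-monoʳ-≤ (fresh x xs * 𝟙 (E? x y)) (ih x)) ⟩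
    ∑[ x < n ] fresh x xs * 𝟙 (E? x y) * extensions p (x ∷ xs) y   ∎
    where
    open ≤-Reasoning
    D : ℕ
    D = deg y ∸ (length xs + suc p)
    D≤fresh : D ≤ ∑[ x < n ] fresh x xs * 𝟙 (E? x y)
    D≤fresh = begin
      deg y ∸ (length xs + suc p)                                  ≤⟨ ∸-monoʳ-≤ (deg y) (m≤m+n (length xs) (suc p)) ⟩
      deg y ∸ length xs                                            ≤⟨ ∸-monoˡ-≤ (length xs) (deg≤fresh-neighbours+length xs y) ⟩
      (∑[ x < n ] fresh x xs * 𝟙 (E? x y)) + length xs ∸ length xs ≡⟨ m+n∸n≡m _ (length xs) ⟩
      ∑[ x < n ] fresh x xs * 𝟙 (E? x y)                           ∎
    ih : ∀ x → D ^ p ≤ extensions p (x ∷ xs) y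
    ih x = subst (λ m → (deg y ∸ m) ^ p ≤ extensions p (x ∷ xs) y) (sym (+-suc (length xs) p))
                 ([deg∸p]^p≤extensions p (x ∷ xs) y)

  -- Pairs (y, ws) with y adjacent to all of xs and ws a sequence of p distinct neighbours of y
  -- outside xs.  Counted by y (for xs = []) there are at least ∑ (deg y − p)^p of them; counted
  -- by the distinct sequence xs ++ ws, each such sequence contributes its codegree.
  completions : ℕ → List ℕ → ℕ
  completions p xs = ∑[ y < n ] adjacentToAll xs y * extensions p xs y

  completions-suc : ∀ p xs → completions (suc p) xs ≡ ∑[ x < n ] fresh x xs * completions p (x ∷ xs)
  completions-suc p xs = begin
    ∑[ y < n ] adjacentToAll xs y * (∑[ x < n ] fresh x xs * 𝟙 (E? x y) * extensions p (x ∷ xs) y)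
      ≡⟨ ∑-cong n (λ y _ → *-distribˡ-∑ n (adjacentToAll xs y) _) ⟩
    ∑[ y < n ] ∑[ x < n ] adjacentToAll xs y * (fresh x xs * 𝟙 (E? x y) * extensions p (x ∷ xs) y)
      ≡⟨ ∑-cong n (λ y _ → ∑-cong n (λ x _ → regroup x y)) ⟩
    ∑[ y < n ] ∑[ x < n ] fresh x xs * (adjacentToAll (x ∷ xs) y * extensions p (x ∷ xs) y)
      ≡⟨ ∑-comm n n _ ⟩
    ∑[ x < n ] ∑[ y < n ] fresh x xs * (adjacentToAll (x ∷ xs) y * extensions p (x ∷ xs) y)
      ≡⟨ ∑-cong n (λ x _ → *-distribˡ-∑ n (fresh x xs) _) ⟨
    ∑[ x < n ] fresh x xs * completions p (x ∷ xs) ∎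
    where
    open ≡-Reasoning
    a*[f*e*t]≡f*[e*a*t] : ∀ a f e t → a * (f * e * t) ≡ f * (e * a * t)
    a*[f*e*t]≡f*[e*a*t] = solve-∀
    regroup : ∀ x y → adjacentToAll xs y * (fresh x xs * 𝟙 (E? x y) * extensions p (x ∷ xs) y)
                    ≡ fresh x xs * (adjacentToAll (x ∷ xs) y * extensions p (x ∷ xs) y)
    regroup x y rewrite 𝟙-× (E? x y) (all? (λ x → E? x y) xs) =
      a*[f*e*t]≡f*[e*a*t] (adjacentToAll xs y) (fresh x xs) (𝟙 (E? x y)) (extensions p (x ∷ xs) y)

  CodegreeBound : ℕ → ℕ → Set
  CodegreeBound P R = ∀ zs → length zs ≡ P → Unique zs → All (_< n) zs → codegree zs ≤ R

  module _ {P R} (bound : CodegreeBound P R) where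

    completions≤ : ∀ p xs → length xs + p ≡ P → Unique xs → All (_< n) xs → completions p xs ≤ R * n ^ p
    completions≤ zero xs len uniq bounded = begin
      ∑[ y < n ] adjacentToAll xs y * 1 ≡⟨ ∑-cong n (λ y _ → *-identityʳ _) ⟩
      codegree xs                       ≤⟨ bound xs (trans (sym (+-identityʳ _)) len) uniq bounded ⟩
      R                                 ≡⟨ *-identityʳ R ⟨
      R * 1                             ∎
      where open ≤-Reasoning
    completions≤ (suc p) xs len uniq bounded = begin
      completions (suc p) xs                          ≡⟨ completions-suc p xs ⟩
      ∑[ x < n ] fresh x xs * completions p (x ∷ xs)  ≤⟨ ∑-bounded n (R * n ^ p) extend ⟩
      n * (R * n ^ p)                                 ≡⟨ x*[y*z]≡y*[x*z] n R (n ^ p) ⟩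
      R * (n * n ^ p)                                 ∎
      where
      open ≤-Reasoning
      x*[y*z]≡y*[x*z] : ∀ x y z → x * (y * z) ≡ y * (x * z)
      x*[y*z]≡y*[x*z] = solve-∀
      extend : ∀ x → x < n → fresh x xs * completions p (x ∷ xs) ≤ R * n ^ p
      extend x x<n with x ∈? xs
      ... | yes _  = z≤n
      ... | no x∉ = ≤-trans (≤-reflexive (+-identityʳ _))
          (completions≤ p (x ∷ xs) (trans (sym (+-suc (length xs) p)) len)
            (¬Any⇒All¬ xs x∉ AllPairs.∷ uniq) (x<n ∷ bounded))

    ∑[deg∸P]^P≤ : ∑[ y < n ] (deg y ∸ P) ^ P ≤ R * n ^ P
    ∑[deg∸P]^P≤ = begin
      ∑[ y < n ] (deg y ∸ P) ^ P       ≤⟨ ∑-mono-≤ n (λ y _ → [deg∸p]^p≤extensions P [] y) ⟩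
      ∑[ y < n ] extensions P [] y     ≡⟨ ∑-cong n (λ y _ → +-identityʳ _) ⟨
      completions P []                 ≤⟨ completions≤ P [] refl AllPairs.[] [] ⟩
      R * n ^ P                        ∎
      where open ≤-Reasoning

module Coloring (n k : ℕ) (f : ℕ → ℕ → ℕ) (f<k : ∀ x y → x < n → y < n → f x y < k) where

  module Class (col : ℕ) = BipartiteGraph (λ x y → f x y ≟ col) n
  open Class using (deg)

  ∑∑-deg≡n² : ∑[ col < k ] ∑[ y < n ] deg col y ≡ n * n
  ∑∑-deg≡n² = begin
    ∑[ col < k ] ∑[ y < n ] ∑[ x < n ] 𝟙 (f x y ≟ col)   ≡⟨ ∑-comm k n _ ⟩
    ∑[ y < n ] ∑[ col < k ] ∑[ x < n ] 𝟙 (f x y ≟ col)   ≡⟨ ∑-cong n (λ y _ → ∑-comm k n _) ⟩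
    ∑[ y < n ] ∑[ x < n ] ∑[ col < k ] 𝟙 (f x y ≟ col)   ≡⟨ ∑-cong n (λ y y<n → ∑-cong n (λ x x<n →
                                                              ∑-𝟙-≡1 (f x y ≟_) k (f<k x y x<n y<n) refl (λ p q → trans (sym p) q))) ⟩
    ∑[ y < n ] ∑[ x < n ] 1                              ≡⟨ ∑-cong n (λ y _ → trans (∑-const n 1) (*-identityʳ n)) ⟩
    ∑[ y < n ] n                                         ≡⟨ ∑-const n n ⟩
    n * n                                                ∎
    where open ≡-Reasoning

  module _ (p R : ℕ) (bound : ∀ col → col < k → Class.CodegreeBound col (suc p) R) where

    P : ℕ
    P = suc p

    S T : ℕ
    S = ∑[ col < k ] ∑[ y < n ] (deg col y ∸ P)
    T = ∑[ col < k ] ∑[ y < n ] (deg col y ∸ P) ^ P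

    n²≤S+knP : n * n ≤ S + k * (n * P)
    n²≤S+knP = begin
      n * n                                                   ≡⟨ ∑∑-deg≡n² ⟨
      ∑[ col < k ] ∑[ y < n ] deg col y                       ≤⟨ ∑-mono-≤ k (λ col _ → ∑-mono-≤ n (λ y _ → m≤m∸P+P (deg col y))) ⟩
      ∑[ col < k ] ∑[ y < n ] (deg col y ∸ P + P)             ≡⟨ ∑∑-distrib-+ k n _ _ ⟩
      S + (∑[ col < k ] ∑[ y < n ] P)                         ≡⟨ cong (S +_) (trans (∑-cong k (λ col _ → ∑-const n P)) (∑-const k (n * P))) ⟩
      S + k * (n * P)                                         ∎
      where
      open ≤-Reasoning
      m≤m∸P+P : ∀ m → m ≤ m ∸ P + P
      m≤m∸P+P m = subst (m ≤_) (+-comm P (m ∸ P)) (m≤n+m∸n m P)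

    S^P≤ : S ^ P ≤ k ^ p * (n ^ p * T)
    S^P≤ = begin
      S ^ P                                                         ≤⟨ power-mean k p _ ⟩
      k ^ p * (∑[ col < k ] (∑[ y < n ] (deg col y ∸ P)) ^ P)       ≤⟨ *-monoʳ-≤ (k ^ p) (∑-mono-≤ k (λ col _ → power-mean n p _)) ⟩
      k ^ p * (∑[ col < k ] n ^ p * (∑[ y < n ] (deg col y ∸ P) ^ P)) ≡⟨ cong (k ^ p *_) (*-distribˡ-∑ k (n ^ p) _) ⟨
      k ^ p * (n ^ p * T)                                           ∎
      where open ≤-Reasoning

    T≤ : T ≤ k * (R * n ^ P)
    T≤ = ∑-bounded k (R * n ^ P) (λ col col<k → Class.∑[deg∸P]^P≤ col (bound col col<k))

    n²≤2S : 2 * (k * P) ≤ n → n * n ≤ 2 * S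
    n²≤2S 2kP≤n = +-cancelʳ-≤ (n * n) (n * n) (2 * S) (begin
      n * n + n * n                 ≡⟨ cong (n * n +_) (+-identityʳ (n * n)) ⟨
      2 * (n * n)                   ≤⟨ *-monoʳ-≤ 2 n²≤S+knP ⟩
      2 * (S + k * (n * P))         ≡⟨ *-distribˡ-+ 2 S _ ⟩
      2 * S + 2 * (k * (n * P))     ≡⟨ cong (λ m → 2 * S + m) (reorder n k P) ⟩
      2 * S + n * (2 * (k * P))     ≤⟨ +-monoʳ-≤ (2 * S) (*-monoʳ-≤ n 2kP≤n) ⟩
      2 * S + n * n                 ∎)
      where
      open ≤-Reasoning
      reorder : ∀ n k P → 2 * (k * (n * P)) ≡ n * (2 * (k * P))
      reorder = solve-∀

    n≤2^P*R*k^P : 1 ≤ n → 2 * (k * P) ≤ n → n ≤ 2 ^ P * R * k ^ P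
    n≤2^P*R*k^P 1≤n 2kP≤n = *-cancelʳ-≤ n (2 ^ P * R * k ^ P) (n ^ p * n ^ P) {{n^p*n^P≢0}} (begin
      n * (n ^ p * n ^ P)                                 ≡⟨ *-assoc n (n ^ p) (n ^ P) ⟨
      n ^ P * n ^ P                                       ≡⟨ ^-distribʳ-* n n P ⟨
      (n * n) ^ P                                         ≤⟨ ^-monoˡ-≤ P (n²≤2S 2kP≤n) ⟩
      (2 * S) ^ P                                         ≡⟨ ^-distribʳ-* 2 S P ⟩
      2 ^ P * S ^ P                                       ≤⟨ *-monoʳ-≤ (2 ^ P) S^P≤ ⟩
      2 ^ P * (k ^ p * (n ^ p * T))                       ≤⟨ *-monoʳ-≤ (2 ^ P) (*-monoʳ-≤ (k ^ p) (*-monoʳ-≤ (n ^ p) T≤)) ⟩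
      2 ^ P * (k ^ p * (n ^ p * (k * (R * n ^ P))))       ≡⟨ reorder (2 ^ P) (k ^ p) (n ^ p) k R (n ^ P) ⟩
      2 ^ P * R * (k * k ^ p) * (n ^ p * n ^ P)           ∎)
      where
      open ≤-Reasoning
      instance
        n^p*n^P≢0 : NonZero (n ^ p * n ^ P)
        n^p*n^P≢0 = m*n≢0 _ _ {{m^n≢0 n p {{>-nonZero 1≤n}}}} {{m^n≢0 n P {{>-nonZero 1≤n}}}}
      reorder : ∀ a b c k R d → a * (b * (c * (k * (R * d)))) ≡ a * R * (k * b) * (c * d)
      reorder = solve-∀

    n≤2P*k^P : 1 ≤ n → n < 2 * (k * P) → n ≤ 2 * P * k ^ P
    n≤2P*k^P 1≤n n<2kP = begin
      n               ≤⟨ <⇒≤ n<2kP ⟩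
      2 * (k * P)     ≡⟨ cong (2 *_) (*-comm k P) ⟩
      2 * (P * k)     ≡⟨ *-assoc 2 P k ⟨
      2 * P * k       ≤⟨ *-monoʳ-≤ (2 * P) k≤k^P ⟩
      2 * P * k ^ P   ∎
      where
      open ≤-Reasoning
      1≤k : 1 ≤ k
      1≤k = ≤-trans (s≤s z≤n) (f<k 0 0 1≤n 1≤n)
      k≤k^P : k ≤ k ^ P
      k≤k^P = subst (_≤ k ^ P) (*-identityʳ k) (*-monoʳ-≤ k (m^n>0 k {{>-nonZero 1≤k}} p))

    kővári-sós-turán : n ≤ (2 ^ P * R + 2 * P) * k ^ P
    kővári-sós-turán with 1 ≤? n | 2 * (k * P) ≤? n
    ... | no  1≰n | _       = ≤-trans (s≤s⁻¹ (≰⇒> 1≰n)) z≤n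
    ... | yes 1≤n | yes 2kP≤n = ≤-trans (n≤2^P*R*k^P 1≤n 2kP≤n) (*-monoˡ-≤ (k ^ P) (m≤m+n (2 ^ P * R) (2 * P)))
    ... | yes 1≤n | no  2kP≰n = ≤-trans (n≤2P*k^P 1≤n (≰⇒> 2kP≰n)) (*-monoˡ-≤ (k ^ P) (m≤n+m (2 * P) (2 ^ P * R)))

-- Copies of K_{s,t} through a monochromatic K_{a,b}

*+<* : ∀ Y {x X y} → x < X → y < Y → Y * x + y < Y * X
*+<* Y {x} {X} {y} x<X y<Y = begin-strict
  Y * x + y   <⟨ +-monoʳ-< (Y * x) y<Y ⟩
  Y * x + Y   ≡⟨ trans (+-comm (Y * x) Y) (sym (*-suc Y x)) ⟩
  Y * suc x   ≤⟨ *-monoʳ-≤ Y x<X ⟩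
  Y * X       ∎
  where open ≤-Reasoning

*+-injective : ∀ Y {x x' y y'} → y < Y → y' < Y → Y * x + y ≡ Y * x' + y' → x ≡ x' × y ≡ y'
*+-injective Y {x} {x'} {y} {y'} y<Y y'<Y eq with <-cmp x x'
... | tri< x<x' _ _ = ⊥-elim (<-irrefl eq (≤-trans (*+<* Y x<x' y<Y) (m≤m+n (Y * x') y')))
... | tri> _ _ x'<x = ⊥-elim (<-irrefl (sym eq) (≤-trans (*+<* Y x'<x y'<Y) (m≤m+n (Y * x) y)))
... | tri≈ _ refl _ = refl , +-cancelˡ-≡ (Y * x) y y' eq

∸-injective : ∀ {x y} c → c ≤ x → c ≤ y → x ∸ c ≡ y ∸ c → x ≡ y
∸-injective {x} {y} c c≤x c≤y eq = begin
  x          ≡⟨ m∸n+n≡m c≤x ⟨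
  x ∸ c + c  ≡⟨ cong (_+ c) eq ⟩
  y ∸ c + c  ≡⟨ m∸n+n≡m c≤y ⟩
  y          ∎
  where open ≡-Reasoning

-- Numbers the cells of [0,s) × [0,t) injectively, except that the block [0,a) × [0,b) collapses to 0;
-- rows i ≥ a come first (row-major), then the cells right of the block.
module BlockCollapse (s t a b : ℕ) where

  cell : ℕ → ℕ → ℕ
  cell i j with i <? a | j <? b
  ... | yes _ | yes _ = 0
  ... | yes _ | no  _ = suc (t * (s ∸ a) + ((t ∸ b) * i + (j ∸ b)))
  ... | no  _ | _     = suc (t * (i ∸ a) + j)

  cells : ℕ
  cells = suc (t * (s ∸ a) + (t ∸ b) * a)

  cell< : ∀ {i j} → i < s → j < t → cell i j < cells
  cell< {i} {j} i<s j<t with i <? a | j <? b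
  ... | yes _   | yes _   = s≤s z≤n
  ... | yes i<a | no  j≮b = s≤s (+-monoʳ-< (t * (s ∸ a)) (*+<* (t ∸ b) i<a (∸-monoˡ-< j<t (≮⇒≥ j≮b))))
  ... | no  i≮a | _       = s≤s (≤-trans (*+<* t (∸-monoˡ-< i<s (≮⇒≥ i≮a)) j<t) (m≤m+n (t * (s ∸ a)) _))

  InBlock : ℕ → ℕ → Set
  InBlock i j = i < a × j < b

  cell-injective : ∀ {i j i' j'} → i < s → j < t → i' < s → j' < t → cell i j ≡ cell i' j' →
                   (InBlock i j × InBlock i' j') ⊎ (i ≡ i' × j ≡ j')
  cell-injective {i} {j} {i'} {j'} i<s j<t i'<s j'<t eq with i <? a | j <? b | i' <? a | j' <? b
  ... | yes i<a | yes j<b | yes i'<a | yes j'<b = inj₁ ((i<a , j<b) , (i'<a , j'<b))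
  ... | yes _   | yes _   | yes _    | no  _    = ⊥-elim (0≢1+n eq)
  ... | yes _   | yes _   | no  _    | _        = ⊥-elim (0≢1+n eq)
  ... | yes _   | no  _   | yes _    | yes _    = ⊥-elim (0≢1+n (sym eq))
  ... | no  _   | _       | yes _    | yes _    = ⊥-elim (0≢1+n (sym eq))
  ... | yes _   | no  j≮b | yes _    | no  j'≮b
    with i≡i' , j∸b≡j'∸b ← *+-injective (t ∸ b) (∸-monoˡ-< j<t (≮⇒≥ j≮b)) (∸-monoˡ-< j'<t (≮⇒≥ j'≮b))
                                       (+-cancelˡ-≡ (t * (s ∸ a)) _ _ (suc-injective eq))
    = inj₂ (i≡i' , ∸-injective b (≮⇒≥ j≮b) (≮⇒≥ j'≮b) j∸b≡j'∸b)
  ... | no  i≮a | _       | no  i'≮a | _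
    with i∸a≡i'∸a , j≡j' ← *+-injective t j<t j'<t (suc-injective eq)
    = inj₂ (∸-injective a (≮⇒≥ i≮a) (≮⇒≥ i'≮a) i∸a≡i'∸a , j≡j')
  ... | yes _   | no  _   | no  i'≮a | _        = ⊥-elim (<-irrefl (sym (suc-injective eq))
          (≤-trans (*+<* t (∸-monoˡ-< i'<s (≮⇒≥ i'≮a)) j'<t) (m≤m+n (t * (s ∸ a)) _)))
  ... | no  i≮a | _       | yes _    | no  _    = ⊥-elim (<-irrefl (suc-injective eq)
          (≤-trans (*+<* t (∸-monoˡ-< i<s (≮⇒≥ i≮a)) j<t) (m≤m+n (t * (s ∸ a)) _)))

  cells≡ : a ≤ s → b ≤ t → cells ≡ s * t ∸ a * b + 1
  cells≡ a≤s b≤t = begin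
    suc (t * (s ∸ a) + (t ∸ b) * a)                       ≡⟨ +-comm 1 _ ⟩
    t * (s ∸ a) + (t ∸ b) * a + 1                         ≡⟨ cong (_+ 1) (m+n∸m≡n (a * b) _) ⟨
    a * b + (t * (s ∸ a) + (t ∸ b) * a) ∸ a * b + 1       ≡⟨ cong (λ m → m ∸ a * b + 1) split ⟨
    s * t ∸ a * b + 1                                     ∎
    where
    open ≡-Reasoning
    expand : ∀ a s' b t' → (a + s') * (b + t') ≡ a * b + ((b + t') * s' + t' * a)
    expand = solve-∀
    split : s * t ≡ a * b + (t * (s ∸ a) + (t ∸ b) * a)
    split = begin
      s * t                                               ≡⟨ cong₂ _*_ (m+[n∸m]≡n a≤s) (m+[n∸m]≡n b≤t) ⟨
      (a + (s ∸ a)) * (b + (t ∸ b))                       ≡⟨ expand a (s ∸ a) b (t ∸ b) ⟩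
      a * b + ((b + (t ∸ b)) * (s ∸ a) + (t ∸ b) * a)     ≡⟨ cong (λ m → a * b + (m * (s ∸ a) + (t ∸ b) * a)) (m+[n∸m]≡n b≤t) ⟩
      a * b + (t * (s ∸ a) + (t ∸ b) * a)                 ∎

module _ {s t a b k} (a≤s : a ≤ s) (b≤t : b ≤ t) (κ : Fin s × Fin t → Fin k) {col : ℕ}
         (constant : ∀ i j → toℕ i < a → toℕ j < b → toℕ (κ (i , j)) ≡ col)
         (g : Fin (s * t ∸ a * b + 2) → Fin s × Fin t) where

  open BlockCollapse s t a b

  private
    cellOf : Fin (s * t ∸ a * b + 2) → Fin cells
    cellOf e = fromℕ< (cell< (toℕ<n (proj₁ (g e))) (toℕ<n (proj₂ (g e))))

    cells<q : cells < s * t ∸ a * b + 2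
    cells<q = ≤-reflexive (trans (cong suc (cells≡ a≤s b≤t)) (sym (+-suc _ 1)))

    same-cell⇒same-colour : ∀ {e e'} → cellOf e ≡ cellOf e' → κ (g e) ≡ κ (g e')
    same-cell⇒same-colour eq
      with cell-injective (toℕ<n _) (toℕ<n _) (toℕ<n _) (toℕ<n _)
             (trans (sym (toℕ-fromℕ< _)) (trans (cong toℕ eq) (toℕ-fromℕ< _)))
    ... | inj₁ ((i<a , j<b) , (i'<a , j'<b)) = toℕ-injective (trans (constant _ _ i<a j<b) (sym (constant _ _ i'<a j'<b)))
    ... | inj₂ (i≡i' , j≡j')                 = cong κ (cong₂ _,_ (toℕ-injective i≡i') (toℕ-injective j≡j'))

  constant-on-block⇒fewer-colours : ¬ Injective _≡_ _≡_ (κ ∘ g)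
  constant-on-block⇒fewer-colours κ∘g-injective
    with e₁ , e₂ , e₁<e₂ , same-cell ← pigeonhole cells<q cellOf
    = <-irrefl (cong toℕ (κ∘g-injective (same-cell⇒same-colour same-cell))) e₁<e₂

Monochromatic : (ℕ → ℕ → ℕ) → ℕ → List ℕ → List ℕ → Set
Monochromatic f col xs ys = All (λ x → All (λ y → f x y ≡ col) ys) xs

NoMonochromaticBlock : (ℕ → ℕ → ℕ) → ℕ → ℕ → ℕ → Set
NoMonochromaticBlock f m a b = ∀ col xs ys → a ≤ length xs → b ≤ length ys → Unique xs → Unique ys →
  All (_< m) xs → All (_< m) ys → ¬ Monochromatic f col xs ys

NoMonochromaticBlock-flip : ∀ {f m a b} → NoMonochromaticBlock f m a b → NoMonochromaticBlock (flip f) m b a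
NoMonochromaticBlock-flip none col xs ys b≤xs a≤ys uxs uys xs<m ys<m mono =
  none col ys xs a≤ys b≤xs uys uxs ys<m xs<m (All-swap mono)

NoMonochromaticBlock⇒CodegreeBound : ∀ {f m a b} → NoMonochromaticBlock f m a b →
  ∀ col → BipartiteGraph.CodegreeBound (λ x y → f x y ≟ col) m a (pred b)
NoMonochromaticBlock⇒CodegreeBound {f} {m} {a} {b} none col zs len uzs zs<m =
  <⇒≤pred (≰⇒> λ b≤codegree →
    none col zs ys (≤-reflexive (sym len)) (≤-trans b≤codegree (≤-reflexive length-ys))
         uzs (Unique.filter⁺ adjacent? (Unique.downFrom⁺ m))
         zs<m (All.filter⁺ adjacent? (applyDownFrom⁺₁ id m id))
         (All-swap (all-filter adjacent? (downFrom m))))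
  where
  open BipartiteGraph (λ x y → f x y ≟ col) m
  adjacent? : ∀ y → Dec (All (λ x → f x y ≡ col) zs)
  adjacent? y = all? (λ x → f x y ≟ col) zs
  ys : List ℕ
  ys = filter adjacent? (downFrom m)
  length-ys : codegree zs ≡ length ys
  length-ys = sym (length-filter-downFrom adjacent? m)

NoMonochromaticBlock⇒few-vertices : ∀ {f m k a b} → 1 ≤ a → (∀ x y → x < m → y < m → f x y < k) →
  NoMonochromaticBlock f m a b → m ≤ (2 ^ a * pred b + 2 * a) * k ^ a
NoMonochromaticBlock⇒few-vertices {a = suc p} _ f<k none =
  Coloring.kővári-sós-turán _ _ _ f<k p _ (λ col _ → NoMonochromaticBlock⇒CodegreeBound none col)

nth : List ℕ → ℕ → ℕ
nth []       _       = 0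
nth (x ∷ xs) zero    = x
nth (x ∷ xs) (suc i) = nth xs i

All-nth : ∀ {p} {P : ℕ → Set p} {xs i} → All P xs → i < length xs → P (nth xs i)
All-nth {i = zero}  (px ∷ _)   _         = px
All-nth {i = suc i} (_  ∷ pxs) (s≤s i<l) = All-nth pxs i<l

nth-injective : ∀ {xs i j} → Unique xs → i < length xs → j < length xs → nth xs i ≡ nth xs j → i ≡ j
nth-injective {_ ∷ _} {zero}  {zero}  _                _         _         _  = refl
nth-injective {_ ∷ _} {zero}  {suc _} (x∉xs AllPairs.∷ _) _        (s≤s j<l) eq = ⊥-elim (All-nth x∉xs j<l eq)
nth-injective {_ ∷ _} {suc _} {zero}  (x∉xs AllPairs.∷ _) (s≤s i<l) _        eq = ⊥-elim (All-nth x∉xs i<l (sym eq))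
nth-injective {_ ∷ _} {suc _} {suc _} (_ AllPairs.∷ uxs) (s≤s i<l) (s≤s j<l) eq = cong suc (nth-injective uxs i<l j<l eq)

pad : ℕ → List ℕ → ℕ → ℕ → ℕ
pad m xs a i with i <? a
... | yes _ = nth xs i
... | no  _ = m + i

module _ {m a xs} (a≤xs : a ≤ length xs) (xs<m : All (_< m) xs) where

  pad-block : ∀ {i} → i < a → pad m xs a i ≡ nth xs i
  pad-block {i} i<a with i <? a
  ... | yes _   = refl
  ... | no  i≮a = ⊥-elim (i≮a i<a)

  pad< : ∀ {i l} → i < l → pad m xs a i < m + l
  pad< {i} i<l with i <? a
  ... | yes i<a = ≤-trans (All-nth xs<m (≤-trans i<a a≤xs)) (m≤m+n m _)
  ... | no  _   = +-monoʳ-< m i<l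

  pad-injective : Unique xs → ∀ {i j} → pad m xs a i ≡ pad m xs a j → i ≡ j
  pad-injective uxs {i} {j} eq with i <? a | j <? a
  ... | yes i<a | yes j<a = nth-injective uxs (≤-trans i<a a≤xs) (≤-trans j<a a≤xs) eq
  ... | yes i<a | no  _   = ⊥-elim (<-irrefl eq (≤-trans (All-nth xs<m (≤-trans i<a a≤xs)) (m≤m+n m j)))
  ... | no  _   | yes j<a = ⊥-elim (<-irrefl (sym eq) (≤-trans (All-nth xs<m (≤-trans j<a a≤xs)) (m≤m+n m i)))
  ... | no  _   | no  _   = +-cancelˡ-≡ m i j eq

toℕ-mod : ∀ {x n} .{{_ : NonZero n}} → x < n → toℕ (x mod n) ≡ x
toℕ-mod x<n = trans (toℕ-fromℕ< _) (m<n⇒m%n≡m x<n)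

module HqColoring {n k s t a b : ℕ} (c : EdgeColoring (suc n) k) (a≤s : a ≤ s) (b≤t : b ≤ t)
  (s+t≤1+n : s + t ≤ suc n) (hq : IsHqColoring (suc n) k s t (s * t ∸ a * b + 2) c) where

  colour : ℕ → ℕ → ℕ
  colour x y = toℕ (c (x mod suc n) (y mod suc n))

  colour<k : ∀ x y → colour x y < k
  colour<k x y = toℕ<n _

  -- the search range; the s + t vertices above it are spare, used to pad a block to a copy of K_{s,t}
  m : ℕ
  m = suc n ∸ (s + t)

  module _ {zs d l} (d≤zs : d ≤ length zs) (zs<m : All (_< m) zs) (uzs : Unique zs) (l≤s+t : l ≤ s + t) where

    vertex : Fin l → Fin (suc n)
    vertex i = pad m zs d (toℕ i) mod suc n

    toℕ-vertex : ∀ i → toℕ (vertex i) ≡ pad m zs d (toℕ i)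
    toℕ-vertex i = toℕ-mod (subst (pad m zs d (toℕ i) <_) (m∸n+n≡m s+t≤1+n)
                     (pad< d≤zs zs<m (≤-trans (toℕ<n i) l≤s+t)))

    vertex-injective : Injective _≡_ _≡_ vertex
    vertex-injective {i} {j} eq = toℕ-injective (pad-injective d≤zs zs<m uzs
      (trans (sym (toℕ-vertex i)) (trans (cong toℕ eq) (toℕ-vertex j))))

  no-monochromatic-block : NoMonochromaticBlock colour m a b
  no-monochromatic-block col xs ys a≤xs b≤ys uxs uys xs<m ys<m mono =
    constant-on-block⇒fewer-colours a≤s b≤t (copyColour c K) constant (proj₁ (hq K)) (proj₂ (hq K))
    where
    L : Fin s → Fin (suc n)
    L = vertex a≤xs xs<m uxs (m≤m+n s t)
    R : Fin t → Fin (suc n)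
    R = vertex b≤ys ys<m uys (m≤n+m t s)
    φ : KV s t → KV (suc n) (suc n)
    φ (inj₁ i) = inj₁ (L i)
    φ (inj₂ j) = inj₂ (R j)
    φ-injective : Injective _≡_ _≡_ φ
    φ-injective {inj₁ _} {inj₁ _} eq = cong inj₁ (vertex-injective a≤xs xs<m uxs (m≤m+n s t) (inj₁-injective eq))
    φ-injective {inj₂ _} {inj₂ _} eq = cong inj₂ (vertex-injective b≤ys ys<m uys (m≤n+m t s) (inj₂-injective eq))
    K : Copy (suc n) s t
    K = record { φ = φ ; φ-inj = φ-injective ; edge = λ i j → lr (L i) (R j) }
    constant : ∀ i j → toℕ i < a → toℕ j < b → toℕ (copyColour c K (i , j)) ≡ col
    constant i j i<a j<b
      rewrite pad-block a≤xs xs<m i<a | pad-block b≤ys ys<m j<b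
      = All-nth (All-nth mono (≤-trans i<a a≤xs)) (≤-trans j<b b≤ys)

  search-range-bound : 1 ≤ a → 1 ≤ b → m ≤ (2 ^ (a ⊓ b) * pred (a ⊔ b) + 2 * (a ⊓ b)) * k ^ (a ⊓ b)
  search-range-bound 1≤a 1≤b with ≤-total a b
  ... | inj₁ a≤b rewrite m≤n⇒m⊓n≡m a≤b | m≤n⇒m⊔n≡n a≤b =
    NoMonochromaticBlock⇒few-vertices 1≤a (λ x y _ _ → colour<k x y) no-monochromatic-block
  ... | inj₂ b≤a rewrite m≥n⇒m⊓n≡n b≤a | m≥n⇒m⊔n≡m b≤a =
    NoMonochromaticBlock⇒few-vertices 1≤b (λ x y _ _ → colour<k y x) (NoMonochromaticBlock-flip no-monochromatic-block)

  vertex-bound : 1 ≤ a → 1 ≤ b →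
    suc n ≤ (2 ^ (a ⊓ b) * pred (a ⊔ b) + 2 * (a ⊓ b) + (s + t)) * k ^ (a ⊓ b)
  vertex-bound 1≤a 1≤b = begin
    suc n                              ≡⟨ m∸n+n≡m s+t≤1+n ⟨
    m + (s + t)                        ≤⟨ +-mono-≤ (search-range-bound 1≤a 1≤b) (m≤m*n (s + t) (k ^ (a ⊓ b))) ⟩
    C * k ^ (a ⊓ b) + (s + t) * k ^ (a ⊓ b) ≡⟨ *-distribʳ-+ (k ^ (a ⊓ b)) C (s + t) ⟨
    (C + (s + t)) * k ^ (a ⊓ b)        ∎
    where
    open ≤-Reasoning
    C : ℕ
    C = 2 ^ (a ⊓ b) * pred (a ⊔ b) + 2 * (a ⊓ b)
    instance
      k^[a⊓b]≢0 : NonZero (k ^ (a ⊓ b))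
      k^[a⊓b]≢0 = m^n≢0 k (a ⊓ b) {{>-nonZero (≤-trans (s≤s z≤n) (colour<k 0 0))}}

-- The argument never uses s + t ≤ a * b.
theorem1p12 : (s t a b : ℕ) → 2 ≤ a → a ≤ s → 2 ≤ b → b ≤ t → s + t ≤ a * b →
    ∃[ C ] ∃[ N ] ((n k : ℕ) → N ≤ n → (c : EdgeColoring n k) →
      IsHqColoring n k s t (s * t ∸ a * b + 2) c → n ≤ C * k ^ (a ⊓ b))
theorem1p12 s t a b 2≤a a≤s 2≤b b≤t _ = C , suc (s + t) , bound
  where
  C : ℕ
  C = 2 ^ (a ⊓ b) * pred (a ⊔ b) + 2 * (a ⊓ b) + (s + t)
  bound : (n k : ℕ) → suc (s + t) ≤ n → (c : EdgeColoring n k) →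
          IsHqColoring n k s t (s * t ∸ a * b + 2) c → n ≤ C * k ^ (a ⊓ b)
  bound (suc n) k (s≤s s+t≤1+n) c hq =
    HqColoring.vertex-bound c a≤s b≤t (m≤n⇒m≤1+n s+t≤1+n) hq (≤-trans (s≤s z≤n) 2≤a) (≤-trans (s≤s z≤n) 2≤b)
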